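{- Let $G$ be a finite group and $S\subseteq G$. The $2$-PCayley graph $\mathrm{BCay}(G,S)$ is $2$PCI if and only if for every $2$-PCayley graph $\mathrm{BCay}(G,T)$ ($T\subseteq G$) isomorphic to $\mathrm{BCay}(G,S)$ there exist $\alpha\in\mathrm{Aut}(G)$ and $g\in G$ such that $T=g^{ -1}S^{\alpha}$ or $T=(S^{ -1})^{\alpha}g$. Moreover, $\mathrm{BCay}(G,S)$ is K$2$PCI if and only if for every $2$-PCayley graph $\mathrm{BCay}(G,T)$ isomorphic to $\mathrm{BCay}(G,S)$ there exist $\alpha\in\mathrm{Aut}(G)$ and $g\in G$ such that $T=g^{ -1}S^{\alpha}$.
   Context: For $S\subseteq G$, $\mathrm{BCay}(G,S)$ is the bipartite graph with vertex set $G_1\cup G_2$, $G_i=\{x_i:x\in G\}$ two disjoint copies of $G$, and edges $\{x_1,(sx)_2\}$ for $s\in S$, $x\in G$ (a $2$-PCayley graph of $G$). $R(g):x_i\mapsto(xg)_i$, $R(G)=\{R(g)\}$; $N$ is the normalizer of $R(G)$ in the symmetric group on $G_1\cup G_2$ and $K$ the kernel of $N$ acting on $\{G_1,G_2\}$. A $2$-PCayley graph $\Gamma$ of $G$ is $2$PCI (resp. K$2$PCI) if for every $2$-PCayley graph $\Sigma$ of $G$ such that some isomorphism $\Gamma\to\Sigma$ maps $\{G_1,G_2\}$ to itself, there exists $n\in N$ (resp. $n\in K$) with $\Gamma^n=\Sigma$. $S^\alpha=\{s^\alpha:s\in S\}$, $S^{ -1}=\{s^{ -1}:s\in S\}$.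 -}

module Defs where

open import Data.Nat using (ℕ)
open import Data.Fin using (Fin)
open import Data.Bool using (Bool; true; false; not)
open import Data.Sum using (_⊎_; inj₁; inj₂)
open import Data.Product using (Σ; ∃; _×_; _,_)
open import Data.Empty using (⊥)
open import Function.Bundles using (_↔_; _⇔_; Inverse)
open import Algebra.Core using (Op₁; Op₂)
open import Algebra.Structures using (IsGroup)
open import Relation.Binary.PropositionalEquality using (_≡_)

record FiniteGroup : Set₁ where
  infixl 7 _∙_
  infix 8 _⁻¹
  field
    Carrier : Set
    _∙_     : Op₂ Carrier
    ε       : Carrier
    _⁻¹     : Op₁ Carrier
    isGroup : IsGroup _≡_ _∙_ ε _⁻¹
    size    : ℕ
    enum    : Carrier ↔ Fin size

module _ (G : FiniteGroup) where
  open FiniteGroup G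

  -- subsets of G (G finite, so Bool-valued characteristic functions)
  Subset : Set
  Subset = Carrier → Bool

  _∈_ : Carrier → Subset → Set
  x ∈ S = S x ≡ true

  _≐_ : Subset → (Carrier → Set) → Set
  T ≐ P = ∀ x → (x ∈ T) ⇔ P x

  -- vertex set G₁ ∪ G₂ : inj₁ x = x₁, inj₂ x = x₂
  Vertex : Set
  Vertex = Carrier ⊎ Carrier

  part : Vertex → Bool
  part (inj₁ _) = false
  part (inj₂ _) = true

  Graph : Set₁
  Graph = Vertex → Vertex → Set

  BCay : Subset → Graph
  BCay S (inj₁ x) (inj₂ y) = ∃ λ s → s ∈ S × y ≡ s ∙ x
  BCay S (inj₂ y) (inj₁ x) = ∃ λ s → s ∈ S × y ≡ s ∙ x
  BCay S (inj₁ _) (inj₁ _) = ⊥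
  BCay S (inj₂ _) (inj₂ _) = ⊥

  Perm : Set
  Perm = Vertex ↔ Vertex

  MapsTo : Perm → Graph → Graph → Set
  MapsTo φ Γ Σ' = ∀ u v → Γ u v ⇔ Σ' (Inverse.to φ u) (Inverse.to φ v)

  Isomorphic : Graph → Graph → Set
  Isomorphic Γ Σ' = ∃ λ (φ : Perm) → MapsTo φ Γ Σ'

  PreservesParts : Perm → Set
  PreservesParts φ = (∀ v → part (Inverse.to φ v) ≡ part v)
                   ⊎ (∀ v → part (Inverse.to φ v) ≡ not (part v))

  R : Carrier → Vertex → Vertex
  R g (inj₁ x) = inj₁ (x ∙ g)
  R g (inj₂ x) = inj₂ (x ∙ g)

  -- n ∈ N : n⁻¹ R(G) n = R(G)  (v^{n⁻¹ R(g) n} = n (R(g) (n⁻¹ v)))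
  InN : Perm → Set
  InN n = (∀ g → ∃ λ h → ∀ v → Inverse.to n (R g (Inverse.from n v)) ≡ R h v)
        × (∀ h → ∃ λ g → ∀ v → Inverse.to n (R g (Inverse.from n v)) ≡ R h v)

  InK : Perm → Set
  InK n = InN n × (∀ v → part (Inverse.to n v) ≡ part v)

  -- 2PCI / K2PCI for Γ = BCay(G,S); the 2-PCayley graphs of G are the BCay(G,T)
  Is2PCI : Subset → Set
  Is2PCI S = ∀ (T : Subset) →
    (∃ λ (φ : Perm) → PreservesParts φ × MapsTo φ (BCay S) (BCay T)) →
    ∃ λ (n : Perm) → InN n × MapsTo n (BCay S) (BCay T)

  IsK2PCI : Subset → Set
  IsK2PCI S = ∀ (T : Subset) →
    (∃ λ (φ : Perm) → PreservesParts φ × MapsTo φ (BCay S) (BCay T)) →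
    ∃ λ (n : Perm) → InK n × MapsTo n (BCay S) (BCay T)

  Aut : Set
  Aut = Σ (Carrier ↔ Carrier) λ α →
          ∀ x y → Inverse.to α (x ∙ y) ≡ Inverse.to α x ∙ Inverse.to α y

  leftForm : Carrier → Aut → Subset → Carrier → Set
  leftForm g (α , _) S x = ∃ λ s → s ∈ S × x ≡ g ⁻¹ ∙ Inverse.to α s

  rightForm : Carrier → Aut → Subset → Carrier → Set
  rightForm g (α , _) S x = ∃ λ s → s ∈ S × x ≡ Inverse.to α (s ⁻¹) ∙ g

-- Every graph isomorphism BCay(G,S) ≅ BCay(G,T) can be made to preserve or swap the parts
-- {G₁, G₂}: on the component of z₁ replace it by R(m) φ R(z⁻¹), which sends the component to that
-- of 1₁ first, so that all components flip the parts as φ does at 1₁.  Thus only elements of N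
-- matter.  An n ∈ N conjugates R(g) to R(σ g) for an automorphism σ, so a part-preserving n is
-- x₁ ↦ (a σ x)₁, y₂ ↦ (b σ y)₂, and the edges at 1₁ give T = g⁻¹ S^α with α = a σ(-) a⁻¹ and
-- g = a b⁻¹; conversely x₁ ↦ (α x)₁, y₂ ↦ (g⁻¹ α y)₂ lies in K.  The swap x₁ ↔ x₂ lies in N and
-- turns BCay(G,X) into BCay(G,X⁻¹), which accounts for the part-swapping elements and the form
-- (S⁻¹)^α g.

module Submission where

open import Level using (Level; _⊔_)
open import Algebra.Bundles using (Group)
open import Algebra.Structures using (IsGroup)
import Algebra.Properties.Group as GroupProperties
open import Data.Bool using (true; false; not; _xor_)
open import Data.Bool.Properties
  using (¬-not; not-¬; not-involutive; xor-annihilates-not; xor-identityʳ; xor-comm; xor-assoc; xor-same)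
  renaming (_≟_ to _≟ᵇ_)
open import Data.Empty using (⊥-elim)
open import Data.Fin using (Fin; zero; suc)
open import Data.Fin.Properties using (any?; +↔⊎) renaming (_≟_ to _≟ᶠ_)
open import Data.Nat using (zero; suc; _+_)
open import Data.Product using (∃; _×_; _,_; proj₁; proj₂)
open import Data.Sum using (_⊎_; inj₁; inj₂; swap)
open import Data.Sum.Properties using (swap-involutive)
open import Data.Sum.Function.Propositional using (_⊎-↔_)
open import Function.Base using (_∘_; id; case_of_)
open import Function.Bundles using (_↔_; _⇔_; Inverse; Equivalence; mk↔ₛ′; mk⇔)
open import Function.Construct.Composition using (_⇔-∘_)
open import Function.Construct.Symmetry using (⇔-sym)
open import Function.Properties.Inverse using (↔-refl; ↔-sym; ↔-trans)
open import Relation.Binary.Core using (Rel)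
open import Relation.Binary.Definitions using (Decidable)
open import Relation.Binary.PropositionalEquality
open import Relation.Binary.Construct.Closure.Equivalence as EqClosure using (EqClosure)
open import Relation.Binary.Construct.Closure.ReflexiveTransitive using (_◅_; _◅◅_) renaming (ε to ε*)
open import Relation.Binary.Construct.Closure.Symmetric using (SymClosure; fwd; bwd)
open import Relation.Nullary using (Dec; yes; no; ¬_)
import Relation.Nullary.Decidable as Dec
open import Relation.Nullary.Decidable using (_×-dec_)

open import Defs hiding (_∈_)
import Defs

open Inverse using (to; from; strictlyInverseˡ; strictlyInverseʳ)

private
  variable
    ℓ₀ ℓ : Level
    A : Set ℓ₀

subst-⇔ : ∀ {p} (P : A → Set p) {x y} → x ≡ y → P x ⇔ P y
subst-⇔ P x≡y = mk⇔ (subst P x≡y) (subst P (sym x≡y))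

xor-cancelˡ : ∀ a b → a xor (a xor b) ≡ b
xor-cancelˡ a b = trans (sym (xor-assoc a a b)) (cong (_xor b) (xor-same a))

-- Component labellings of finite graphs

symClosure? : {E : Rel A ℓ} → Decidable E → Decidable (SymClosure E)
symClosure? E? x y with E? x y | E? y x
... | yes xy | _      = yes (fwd xy)
... | no _   | yes yx = yes (bwd yx)
... | no ¬xy | no ¬yx = no λ { (fwd xy) → ¬xy xy ; (bwd yx) → ¬yx yx }

record IsComponentLabelling {a ℓ} {A : Set a} (E : Rel A ℓ) (c : A → A) : Set (a ⊔ ℓ) where
  field
    constant  : ∀ {x y} → E x y → c x ≡ c y
    connected : ∀ x → EqClosure E x (c x)

  constant-on-paths : ∀ {x y} → EqClosure E x y → c x ≡ c y
  constant-on-paths = EqClosure.gfold isEquivalence c constant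

  idempotent : ∀ x → c (c x) ≡ c x
  idempotent x = sym (constant-on-paths (connected x))

  postcompose : (g : A → A) → (∀ x → EqClosure E x (g x)) → IsComponentLabelling E (g ∘ c)
  postcompose g g-connected = record
    { constant  = cong g ∘ constant
    ; connected = λ x → connected x ◅◅ g-connected (c x)
    }

-- Label the vertices suc i by induction, then merge into zero every label whose component contains
-- a neighbour of zero.
componentLabelling-Fin : ∀ n (E : Rel (Fin n) ℓ) → Decidable E → ∃ (IsComponentLabelling E)
componentLabelling-Fin zero E E? = (λ ()) , record { constant = λ { {()} } ; connected = λ () }
componentLabelling-Fin {ℓ} (suc n) E E? = c , record { constant = c-constant ; connected = c-connected }
  where
  E₀ : Rel (Fin n) ℓ
  E₀ i j = E (suc i) (suc j)

  c₀ : Fin n → Fin n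
  c₀ = proj₁ (componentLabelling-Fin n E₀ (λ i j → E? (suc i) (suc j)))
  open IsComponentLabelling (proj₂ (componentLabelling-Fin n E₀ (λ i j → E? (suc i) (suc j))))
    renaming (constant to c₀-constant; connected to c₀-connected)

  lift : ∀ {i j} → EqClosure E₀ i j → EqClosure E (suc i) (suc j)
  lift = EqClosure.gmap suc (λ e → e)

  MeetsZero : Fin n → Set ℓ
  MeetsZero k = ∃ λ j → SymClosure E zero (suc j) × k ≡ c₀ j

  meetsZero? : ∀ k → Dec (MeetsZero k)
  meetsZero? k = any? λ j → symClosure? E? zero (suc j) ×-dec (k ≟ᶠ c₀ j)

  relabel : ∀ k → Dec (MeetsZero k) → Fin (suc n)
  relabel k (yes _) = zero
  relabel k (no _)  = suc k

  c : Fin (suc n) → Fin (suc n)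
  c zero    = zero
  c (suc i) = relabel (c₀ i) (meetsZero? (c₀ i))

  c-meetsZero : ∀ {j} → SymClosure E zero (suc j) → c (suc j) ≡ zero
  c-meetsZero {j} e with meetsZero? (c₀ j)
  ... | yes _  = refl
  ... | no ¬m  = ⊥-elim (¬m (j , e , refl))

  relabel-cong : ∀ {k l} → k ≡ l → relabel k (meetsZero? k) ≡ relabel l (meetsZero? l)
  relabel-cong refl = refl

  c-constant : ∀ {x y} → E x y → c x ≡ c y
  c-constant {zero}  {zero}  e = refl
  c-constant {zero}  {suc j} e = sym (c-meetsZero (fwd e))
  c-constant {suc i} {zero}  e = c-meetsZero (bwd e)
  c-constant {suc i} {suc j} e = relabel-cong (c₀-constant e)

  relabel-connected : ∀ i → (m : Dec (MeetsZero (c₀ i))) → EqClosure E (suc i) (relabel (c₀ i) m)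
  relabel-connected i (yes (j , e , c₀i≡c₀j)) =
    lift (c₀-connected i) ◅◅ subst (λ k → EqClosure E (suc k) (suc j)) (sym c₀i≡c₀j)
      (lift (EqClosure.symmetric E₀ (c₀-connected j))) ◅◅ EqClosure.symmetric E (e ◅ ε*)
  relabel-connected i (no _) = lift (c₀-connected i)

  c-connected : ∀ x → EqClosure E x (c x)
  c-connected zero    = ε*
  c-connected (suc i) = relabel-connected i (meetsZero? (c₀ i))

componentLabelling : ∀ {n} {E : Rel A ℓ} → A ↔ Fin n → Decidable E → ∃ (IsComponentLabelling E)
componentLabelling {n = n} {E} e E? = from e ∘ proj₁ L ∘ to e , record { constant = c-constant ; connected = c-connected }
  where
  L = componentLabelling-Fin n (λ i j → E (from e i) (from e j)) (λ i j → E? (from e i) (from e j))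
  open IsComponentLabelling (proj₂ L)

  c-constant : ∀ {x y} → E x y → from e (proj₁ L (to e x)) ≡ from e (proj₁ L (to e y))
  c-constant {x} {y} xy = cong (from e) (constant (subst₂ E (sym (strictlyInverseʳ e x)) (sym (strictlyInverseʳ e y)) xy))

  c-connected : ∀ x → EqClosure E x (from e (proj₁ L (to e x)))
  c-connected x = subst (λ z → EqClosure E z (from e (proj₁ L (to e x)))) (strictlyInverseʳ e x)
    (EqClosure.gmap (from e) id (connected (to e x)))

-- Gluing isomorphisms componentwise

record IsIsomorphism {V W : Set} (φ : V ↔ W) (Γ : V → V → Set) (Δ : W → W → Set) : Set where
  constructor isIsomorphism
  field
    adjacent⇔ : ∀ u v → Γ u v ⇔ Δ (to φ u) (to φ v)

  preserves : ∀ {u v} → Γ u v → Δ (to φ u) (to φ v)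
  preserves = Equivalence.to (adjacent⇔ _ _)

  reflects : ∀ {u v} → Δ (to φ u) (to φ v) → Γ u v
  reflects = Equivalence.from (adjacent⇔ _ _)

open IsIsomorphism

module _ {V W : Set} {Γ : V → V → Set} {Δ : W → W → Set} {φ : V ↔ W} (φ-iso : IsIsomorphism φ Γ Δ) where

  iso-sym : IsIsomorphism (↔-sym φ) Δ Γ
  iso-sym = isIsomorphism λ u v → mk⇔
    (λ e → reflects φ-iso (subst₂ Δ (sym (strictlyInverseˡ φ u)) (sym (strictlyInverseˡ φ v)) e))
    (λ e → subst₂ Δ (strictlyInverseˡ φ u) (strictlyInverseˡ φ v) (preserves φ-iso e))

  iso-preserves-connected : ∀ {u v} → EqClosure Γ u v → EqClosure Δ (to φ u) (to φ v)
  iso-preserves-connected = EqClosure.gmap (to φ) (preserves φ-iso)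

  iso-reflects-connected : ∀ {u v} → EqClosure Δ (to φ u) (to φ v) → EqClosure Γ u v
  iso-reflects-connected {u} {v} p =
    subst₂ (EqClosure Γ) (strictlyInverseʳ φ u) (strictlyInverseʳ φ v) (EqClosure.gmap (from φ) (preserves iso-sym) p)

iso-∘ : {U V W : Set} {Γ : U → U → Set} {Δ : V → V → Set} {Θ : W → W → Set} {φ : U ↔ V} {ψ : V ↔ W} →
        IsIsomorphism φ Γ Δ → IsIsomorphism ψ Δ Θ → IsIsomorphism (↔-trans φ ψ) Γ Θ
iso-∘ φ-iso ψ-iso = isIsomorphism λ u v → adjacent⇔ ψ-iso _ _ ⇔-∘ adjacent⇔ φ-iso u v

-- On the component C of each representative z, φ is replaced by an isomorphism F z that maps z
-- into φ(C); then F z, like φ, maps C onto φ(C), so the pieces fit together into a bijection.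
module ComponentwiseGluing
  {V W : Set} {Γ : V → V → Set} {Δ : W → W → Set}
  (φ : V ↔ W) (φ-iso : IsIsomorphism φ Γ Δ)
  (c : V → V) (c-labelling : IsComponentLabelling Γ c)
  (F : V → V ↔ W) (F-iso : ∀ z → IsIsomorphism (F z) Γ Δ)
  (F-near : ∀ z → EqClosure Δ (to (F z) z) (to φ z))
  where

  open IsComponentLabelling c-labelling

  F-near-component : ∀ {v z} → EqClosure Γ v z → EqClosure Δ (to (F z) v) (to φ v)
  F-near-component {v} {z} v~z =
    iso-preserves-connected (F-iso z) v~z ◅◅ F-near z ◅◅ iso-preserves-connected φ-iso (EqClosure.symmetric Γ v~z)

  glue : V → W
  glue v = to (F (c v)) v

  unglue : W → V
  unglue w = from (F (c (from φ w))) w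

  glue-connected : ∀ v → EqClosure Γ (from φ (glue v)) v
  glue-connected v = iso-reflects-connected φ-iso
    (subst (λ w → EqClosure Δ w (to φ v)) (sym (strictlyInverseˡ φ (glue v))) (F-near-component (connected v)))

  unglue-connected : ∀ w → EqClosure Γ (unglue w) (c (from φ w))
  unglue-connected w = iso-reflects-connected (F-iso z)
    (subst (λ w′ → EqClosure Δ w′ (to (F z) z)) (trans (strictlyInverseˡ φ w) (sym (strictlyInverseˡ (F z) w)))
      (iso-preserves-connected φ-iso (connected (from φ w)) ◅◅ EqClosure.symmetric Δ (F-near z)))
    where z = c (from φ w)

  unglue-glue : ∀ v → unglue (glue v) ≡ v
  unglue-glue v rewrite constant-on-paths (glue-connected v) = strictlyInverseʳ (F (c v)) v

  glue-unglue : ∀ w → glue (unglue w) ≡ w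
  glue-unglue w rewrite constant-on-paths (unglue-connected w) | idempotent (from φ w) =
    strictlyInverseˡ (F (c (from φ w))) w

  glued : V ↔ W
  glued = mk↔ₛ′ glue unglue glue-unglue unglue-glue

  glued-iso : IsIsomorphism glued Γ Δ
  glued-iso = isIsomorphism λ u v → mk⇔ (preserve u v) (reflect u v)
    where
    preserve : ∀ u v → Γ u v → Δ (glue u) (glue v)
    preserve u v e rewrite constant e = preserves (F-iso (c v)) e

    reflect : ∀ u v → Δ (glue u) (glue v) → Γ u v
    reflect u v e = reflects (F-iso (c v)) (subst (λ z → Δ (to (F z) u) (glue v)) cu≡cv e)
      where
      cu≡cv : c u ≡ c v
      cu≡cv = constant-on-paths (iso-reflects-connected φ-iso
        (EqClosure.symmetric Δ (F-near-component (connected u)) ◅◅ fwd e ◅ ε* ◅◅ F-near-component (connected v)))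

module Cayley (G : FiniteGroup) where
  open FiniteGroup G
  open IsGroup isGroup using (assoc; identityˡ; identityʳ; inverseˡ; inverseʳ)

  group : Group _ _
  group = record { Carrier = Carrier ; _≈_ = _≡_ ; _∙_ = _∙_ ; ε = ε ; _⁻¹ = _⁻¹ ; isGroup = isGroup }

  open GroupProperties group
    using (∙-cancelˡ; ∙-cancelʳ; ⁻¹-involutive; ⁻¹-anti-homo-∙; inverseˡ-unique;
           \\-leftDividesˡ; \\-leftDividesʳ; //-rightDividesˡ; //-rightDividesʳ)

  infix 4 _∈_
  _∈_ : Carrier → Subset G → Set
  _∈_ = Defs._∈_ G

  ∈-resp-≡ : ∀ {X x y} → x ≡ y → x ∈ X → y ∈ X
  ∈-resp-≡ {X} = subst (_∈ X)

  [x⁻¹∙y]⁻¹≡y⁻¹∙x : ∀ x y → (x ⁻¹ ∙ y) ⁻¹ ≡ y ⁻¹ ∙ x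
  [x⁻¹∙y]⁻¹≡y⁻¹∙x x y = trans (⁻¹-anti-homo-∙ (x ⁻¹) y) (cong (y ⁻¹ ∙_) (⁻¹-involutive x))

  [x∙y⁻¹]⁻¹≡y∙x⁻¹ : ∀ x y → (x ∙ y ⁻¹) ⁻¹ ≡ y ∙ x ⁻¹
  [x∙y⁻¹]⁻¹≡y∙x⁻¹ x y = trans (⁻¹-anti-homo-∙ x (y ⁻¹)) (cong (_∙ x ⁻¹) (⁻¹-involutive y))

  module _ (α : Aut G) where
    private
      α→ = to (proj₁ α)
      α-homo = proj₂ α

    aut-ε : α→ ε ≡ ε
    aut-ε = sym (∙-cancelˡ (α→ ε) _ _ (begin
      α→ ε ∙ ε      ≡⟨ identityʳ _ ⟩
      α→ ε          ≡⟨ cong α→ (identityʳ ε) ⟨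
      α→ (ε ∙ ε)    ≡⟨ α-homo ε ε ⟩
      α→ ε ∙ α→ ε   ∎))
      where open ≡-Reasoning

    aut-⁻¹ : ∀ x → α→ (x ⁻¹) ≡ α→ x ⁻¹
    aut-⁻¹ x = inverseˡ-unique _ _ (trans (sym (α-homo (x ⁻¹) x)) (trans (cong α→ (inverseˡ x)) aut-ε))

  infixr 9 _∘ᴬ_
  _∘ᴬ_ : Aut G → Aut G → Aut G
  (α , α-homo) ∘ᴬ (β , β-homo) = ↔-trans β α , λ x y → trans (cong (to α) (β-homo x y)) (α-homo _ _)

  inner : Carrier → Aut G
  inner a = mk↔ₛ′ (λ x → (a ∙ x) ∙ a ⁻¹) (λ x → (a ⁻¹ ∙ x) ∙ a) to-from from-to , homo
    where
    open ≡-Reasoning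
    to-from : ∀ x → (a ∙ ((a ⁻¹ ∙ x) ∙ a)) ∙ a ⁻¹ ≡ x
    to-from x = begin
      (a ∙ ((a ⁻¹ ∙ x) ∙ a)) ∙ a ⁻¹  ≡⟨ cong (_∙ a ⁻¹) (assoc a (a ⁻¹ ∙ x) a) ⟨
      ((a ∙ (a ⁻¹ ∙ x)) ∙ a) ∙ a ⁻¹  ≡⟨ cong (λ z → (z ∙ a) ∙ a ⁻¹) (\\-leftDividesˡ a x) ⟩
      (x ∙ a) ∙ a ⁻¹                 ≡⟨ //-rightDividesʳ a x ⟩
      x                              ∎
    from-to : ∀ x → (a ⁻¹ ∙ ((a ∙ x) ∙ a ⁻¹)) ∙ a ≡ x
    from-to x = begin
      (a ⁻¹ ∙ ((a ∙ x) ∙ a ⁻¹)) ∙ a  ≡⟨ cong (_∙ a) (assoc (a ⁻¹) (a ∙ x) (a ⁻¹)) ⟨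
      ((a ⁻¹ ∙ (a ∙ x)) ∙ a ⁻¹) ∙ a  ≡⟨ cong (λ z → (z ∙ a ⁻¹) ∙ a) (\\-leftDividesʳ a x) ⟩
      (x ∙ a ⁻¹) ∙ a                 ≡⟨ //-rightDividesˡ a x ⟩
      x                              ∎
    homo : ∀ x y → (a ∙ (x ∙ y)) ∙ a ⁻¹ ≡ ((a ∙ x) ∙ a ⁻¹) ∙ ((a ∙ y) ∙ a ⁻¹)
    homo x y = sym (begin
      ((a ∙ x) ∙ a ⁻¹) ∙ ((a ∙ y) ∙ a ⁻¹)  ≡⟨ assoc _ (a ∙ y) (a ⁻¹) ⟨
      (((a ∙ x) ∙ a ⁻¹) ∙ (a ∙ y)) ∙ a ⁻¹  ≡⟨ cong (_∙ a ⁻¹) (assoc (a ∙ x) (a ⁻¹) (a ∙ y)) ⟩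
      ((a ∙ x) ∙ (a ⁻¹ ∙ (a ∙ y))) ∙ a ⁻¹  ≡⟨ cong (λ z → ((a ∙ x) ∙ z) ∙ a ⁻¹) (\\-leftDividesʳ a y) ⟩
      ((a ∙ x) ∙ y) ∙ a ⁻¹                 ≡⟨ cong (_∙ a ⁻¹) (assoc a x y) ⟩
      (a ∙ (x ∙ y)) ∙ a ⁻¹                 ∎)

  el : Vertex G → Carrier
  el (inj₁ x) = x
  el (inj₂ x) = x

  R-∙ : ∀ g h v → R G g (R G h v) ≡ R G (h ∙ g) v
  R-∙ g h (inj₁ x) = cong inj₁ (assoc x h g)
  R-∙ g h (inj₂ x) = cong inj₂ (assoc x h g)

  R-cancel : ∀ g v → R G (g ⁻¹) (R G g v) ≡ v
  R-cancel g (inj₁ x) = cong inj₁ (//-rightDividesʳ g x)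
  R-cancel g (inj₂ x) = cong inj₂ (//-rightDividesʳ g x)

  R-cancel⁻¹ : ∀ g v → R G g (R G (g ⁻¹) v) ≡ v
  R-cancel⁻¹ g (inj₁ x) = cong inj₁ (//-rightDividesˡ g x)
  R-cancel⁻¹ g (inj₂ x) = cong inj₂ (//-rightDividesˡ g x)

  R-injective : ∀ {g h} v → R G g v ≡ R G h v → g ≡ h
  R-injective (inj₁ x) eq = ∙-cancelˡ x _ _ (cong el eq)
  R-injective (inj₂ x) eq = ∙-cancelˡ x _ _ (cong el eq)

  part-R : ∀ g v → part G (R G g v) ≡ part G v
  part-R g (inj₁ x) = refl
  part-R g (inj₂ x) = refl

  R-between : ∀ {u v} → part G u ≡ part G v → R G (el u ⁻¹ ∙ el v) u ≡ v
  R-between {inj₁ x} {inj₁ y} _ = cong inj₁ (\\-leftDividesˡ x y)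
  R-between {inj₂ x} {inj₂ y} _ = cong inj₂ (\\-leftDividesˡ x y)

  R↔ : Carrier → Perm G
  R↔ g = mk↔ₛ′ (R G g) (R G (g ⁻¹)) (R-cancel⁻¹ g) (R-cancel g)

  BCay-R : ∀ {X} g {u v} → BCay G X u v → BCay G X (R G g u) (R G g v)
  BCay-R g {inj₁ x} {inj₂ y} (s , s∈X , y≡sx) = s , s∈X , trans (cong (_∙ g) y≡sx) (assoc s x g)
  BCay-R g {inj₂ y} {inj₁ x} (s , s∈X , y≡sx) = s , s∈X , trans (cong (_∙ g) y≡sx) (assoc s x g)

  R-iso : ∀ {X} g → IsIsomorphism (R↔ g) (BCay G X) (BCay G X)
  R-iso {X} g = isIsomorphism λ u v → mk⇔ (BCay-R g)
    λ e → subst₂ (BCay G X) (R-cancel g u) (R-cancel g v) (BCay-R (g ⁻¹) e)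

  BCay-flips-part : ∀ {X u v} → BCay G X u v → part G v ≡ not (part G u)
  BCay-flips-part {u = inj₁ x} {inj₂ y} _ = refl
  BCay-flips-part {u = inj₂ y} {inj₁ x} _ = refl

  ∈⇔BCay : ∀ {X x y} → x ∈ X ⇔ BCay G X (inj₁ y) (inj₂ (x ∙ y))
  ∈⇔BCay {y = y} = mk⇔ (λ x∈X → _ , x∈X , refl)
    λ { (s , s∈X , xy≡sy) → ∈-resp-≡ (sym (∙-cancelʳ y _ _ xy≡sy)) s∈X }

  BCay? : ∀ X → Decidable (BCay G X)
  BCay? X (inj₁ x) (inj₂ y) = Dec.map (edge⇔ x y) (X (y ∙ x ⁻¹) ≟ᵇ true)
    where edge⇔ : ∀ x y → y ∙ x ⁻¹ ∈ X ⇔ BCay G X (inj₁ x) (inj₂ y)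
          edge⇔ x y = subst (λ z → y ∙ x ⁻¹ ∈ X ⇔ BCay G X (inj₁ x) (inj₂ z)) (//-rightDividesˡ x y) ∈⇔BCay
  BCay? X (inj₂ y) (inj₁ x) = BCay? X (inj₁ x) (inj₂ y)
  BCay? X (inj₁ _) (inj₁ _) = no λ ()
  BCay? X (inj₂ _) (inj₂ _) = no λ ()

  Vertex↔Fin : Vertex G ↔ Fin (size + size)
  Vertex↔Fin = ↔-trans (enum ⊎-↔ enum) (↔-sym +↔⊎)

  -- Part-preserving isomorphisms

  part-flip-constant : ∀ {S T φ} → IsIsomorphism φ (BCay G S) (BCay G T) → ∀ {u v} → EqClosure (BCay G S) u v →
                       part G u xor part G (to φ u) ≡ part G v xor part G (to φ v)
  part-flip-constant {φ = φ} φ-iso = EqClosure.gfold isEquivalence (λ v → part G v xor part G (to φ v)) flip-edge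
    where
    flip-edge : ∀ {u v} → BCay G _ u v → part G u xor part G (to φ u) ≡ part G v xor part G (to φ v)
    flip-edge {u} e rewrite BCay-flips-part e | BCay-flips-part (preserves φ-iso e) =
      sym (xor-annihilates-not (part G u) _)

  preservesParts-xor : ∀ ψ b → (∀ v → part G (to ψ v) ≡ part G v xor b) → PreservesParts G ψ
  preservesParts-xor ψ false ψ-part = inj₁ λ v → trans (ψ-part v) (xor-identityʳ (part G v))
  preservesParts-xor ψ true  ψ-part = inj₂ λ v → trans (ψ-part v) (xor-comm (part G v) true)

  neighbour : ∀ {X s₀} → s₀ ∈ X → ∀ z → ∃ (BCay G X z)
  neighbour {s₀ = s₀} s₀∈X (inj₁ x) = inj₂ (s₀ ∙ x) , s₀ , s₀∈X , refl
  neighbour {s₀ = s₀} s₀∈X (inj₂ y) = inj₁ (s₀ ⁻¹ ∙ y) , s₀ , s₀∈X , sym (\\-leftDividesˡ s₀ y)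

  translate-near : ∀ {X y y′} → BCay G X y y′ → ∀ w → ∃ λ m → EqClosure (BCay G X) (R G m w) y
  translate-near {X} {y} {y′} e w with part G w ≟ᵇ part G y
  ... | yes w∼y = el w ⁻¹ ∙ el y , subst (λ z → EqClosure (BCay G X) z y) (sym (R-between w∼y)) ε*
  ... | no  w≁y = el w ⁻¹ ∙ el y′ , subst (λ z → EqClosure (BCay G X) z y) (sym (R-between w∼y′)) (bwd e ◅ ε*)
    where w∼y′ = trans (¬-not w≁y) (sym (BCay-flips-part e))

  -- Representatives are taken in G₁, so that R(z⁻¹) sends each of them to 1₁.
  module PartPreserving {S T : Subset G} {s₀ : Carrier} (s₀∈S : s₀ ∈ S)
                        (φ : Perm G) (φ-iso : IsIsomorphism φ (BCay G S) (BCay G T)) where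

    toG₁ : Vertex G → Vertex G
    toG₁ (inj₁ x) = inj₁ x
    toG₁ (inj₂ y) = inj₁ (s₀ ⁻¹ ∙ y)

    toG₁-connected : ∀ v → EqClosure (BCay G S) v (toG₁ v)
    toG₁-connected (inj₁ x) = ε*
    toG₁-connected (inj₂ y) = fwd (proj₂ (neighbour s₀∈S (inj₂ y))) ◅ ε*

    toG₁-to-1 : ∀ v → R G (el (toG₁ v) ⁻¹) (toG₁ v) ≡ inj₁ ε
    toG₁-to-1 (inj₁ x) = cong inj₁ (inverseʳ x)
    toG₁-to-1 (inj₂ y) = cong inj₁ (inverseʳ (s₀ ⁻¹ ∙ y))

    rep : Vertex G → Vertex G
    rep = toG₁ ∘ proj₁ (componentLabelling Vertex↔Fin (BCay? S))

    rep-labelling : IsComponentLabelling (BCay G S) rep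
    rep-labelling = IsComponentLabelling.postcompose (proj₂ (componentLabelling Vertex↔Fin (BCay? S))) toG₁ toG₁-connected

    shift : ∀ z → ∃ λ m → EqClosure (BCay G T) (R G m (to φ (R G (el z ⁻¹) z))) (to φ z)
    shift z = translate-near (preserves φ-iso (proj₂ (neighbour s₀∈S z))) _

    F : Vertex G → Perm G
    F z = ↔-trans (R↔ (el z ⁻¹)) (↔-trans φ (R↔ (proj₁ (shift z))))

    open ComponentwiseGluing φ φ-iso rep rep-labelling F
      (λ z → iso-∘ (R-iso (el z ⁻¹)) (iso-∘ φ-iso (R-iso (proj₁ (shift z)))))
      (proj₂ ∘ shift)
      public using (glued; glued-iso)

    glued-part : ∀ v → part G (to glued v) ≡ part G v xor part G (to φ (inj₁ ε))
    glued-part v = begin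
      part G (to glued v)                       ≡⟨ part-R _ _ ⟩
      part G (to φ w)                           ≡⟨ xor-cancelˡ (part G w) _ ⟨
      part G w xor (part G w xor part G (to φ w)) ≡⟨ cong₂ _xor_ (part-R _ v) (part-flip-constant φ-iso w∼1) ⟩
      part G v xor part G (to φ (inj₁ ε))       ∎
      where
      open ≡-Reasoning
      z = rep v
      w = R G (el z ⁻¹) v
      w∼1 : EqClosure (BCay G S) w (inj₁ ε)
      w∼1 = subst (EqClosure (BCay G S) w) (toG₁-to-1 _)
              (iso-preserves-connected (R-iso (el z ⁻¹)) (IsComponentLabelling.connected rep-labelling v))

    glued-preservesParts : PreservesParts G glued
    glued-preservesParts = preservesParts-xor glued _ glued-part

  nonempty? : ∀ X → Dec (∃ λ s → s ∈ X)
  nonempty? X = Dec.map′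
    (λ (i , p) → from enum i , p)
    (λ (s , s∈X) → to enum s , ∈-resp-≡ {X} (sym (strictlyInverseʳ enum s)) s∈X)
    (any? λ i → X (from enum i) ≟ᵇ true)

  no-edges : ∀ {X} → ¬ (∃ λ s → s ∈ X) → ∀ {u v} → ¬ BCay G X u v
  no-edges empty {inj₁ _} {inj₂ _} (s , s∈X , _) = empty (s , s∈X)
  no-edges empty {inj₂ _} {inj₁ _} (s , s∈X , _) = empty (s , s∈X)

  partPreservingIsomorphism : ∀ {S T} φ → IsIsomorphism φ (BCay G S) (BCay G T) →
    ∃ λ ψ → PreservesParts G ψ × IsIsomorphism ψ (BCay G S) (BCay G T)
  partPreservingIsomorphism {S} φ φ-iso with nonempty? S
  ... | yes (_ , s₀∈S) = glued , glued-preservesParts , glued-iso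
    where open PartPreserving s₀∈S φ φ-iso
  ... | no empty = ↔-refl , inj₁ (λ _ → refl) , isIsomorphism λ u v → mk⇔
    (λ e → ⊥-elim (no-edges empty e))
    (λ e → ⊥-elim (no-edges empty (preserves (iso-sym φ-iso) e)))

  -- The normaliser of R(G)

  InN-∘ : ∀ {n m} → InN G n → InN G m → InN G (↔-trans n m)
  InN-∘ {n} {m} (n⇒ , n⇐) (m⇒ , m⇐) =
    (λ g → let (h , n-conj) = n⇒ g ; (k , m-conj) = m⇒ h in k , chain n-conj m-conj) ,
    (λ k → let (h , m-conj) = m⇐ k ; (g , n-conj) = n⇐ h in g , chain n-conj m-conj)
    where
    chain : ∀ {g h k} → (∀ v → to n (R G g (from n v)) ≡ R G h v) → (∀ v → to m (R G h (from m v)) ≡ R G k v) →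
            ∀ v → to m (to n (R G g (from n (from m v)))) ≡ R G k v
    chain n-conj m-conj v = trans (cong (to m) (n-conj (from m v))) (m-conj v)

  swap↔ : Perm G
  swap↔ = mk↔ₛ′ swap swap swap-involutive swap-involutive

  part-swap : ∀ v → part G (swap v) ≡ not (part G v)
  part-swap (inj₁ _) = refl
  part-swap (inj₂ _) = refl

  swap-InN : InN G swap↔
  swap-InN = (λ g → g , swap-R g) , (λ g → g , swap-R g)
    where
    swap-R : ∀ g v → swap (R G g (swap v)) ≡ R G g v
    swap-R g (inj₁ _) = refl
    swap-R g (inj₂ _) = refl

  swap-iso : ∀ {X Y} → (∀ x → Y x ≡ X (x ⁻¹)) → IsIsomorphism swap↔ (BCay G X) (BCay G Y)
  swap-iso {X} {Y} Y≡X⁻¹ = isIsomorphism λ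
    { (inj₁ x) (inj₂ y) → reversed x y
    ; (inj₂ y) (inj₁ x) → reversed x y
    ; (inj₁ _) (inj₁ _) → mk⇔ (λ ()) (λ ())
    ; (inj₂ _) (inj₂ _) → mk⇔ (λ ()) (λ ())
    }
    where
    reverse-edge : ∀ {s x y} → y ≡ s ∙ x → x ≡ s ⁻¹ ∙ y
    reverse-edge {s} {x} y≡sx = trans (sym (\\-leftDividesʳ s x)) (cong (s ⁻¹ ∙_) (sym y≡sx))

    reversed : ∀ x y → (∃ λ s → s ∈ X × y ≡ s ∙ x) ⇔ (∃ λ t → t ∈ Y × x ≡ t ∙ y)
    reversed x y = mk⇔
      (λ (s , s∈X , y≡sx) → s ⁻¹ , trans (Y≡X⁻¹ (s ⁻¹)) (trans (cong X (⁻¹-involutive s)) s∈X) , reverse-edge y≡sx)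
      (λ (t , t∈Y , x≡ty) → t ⁻¹ , trans (sym (Y≡X⁻¹ t)) t∈Y , reverse-edge x≡ty)

  _⁻¹ˢ : Subset G → Subset G
  (X ⁻¹ˢ) x = X (x ⁻¹)

  rightForm⇔leftForm⁻¹ : ∀ {S g α} x → rightForm G g α S x ⇔ leftForm G g α S (x ⁻¹)
  rightForm⇔leftForm⁻¹ {g = g} {α} x = mk⇔
    (λ (s , s∈S , x≡) → s , s∈S , trans (cong _⁻¹ (trans x≡ (cong (_∙ g) (aut-⁻¹ α s)))) ([x⁻¹∙y]⁻¹≡y⁻¹∙x (to (proj₁ α) s) g))
    (λ (s , s∈S , x⁻¹≡) → s , s∈S , trans (sym (⁻¹-involutive x))
                                     (trans (cong _⁻¹ x⁻¹≡) (trans ([x⁻¹∙y]⁻¹≡y⁻¹∙x g _) (cong (_∙ g) (sym (aut-⁻¹ α s))))))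

  leftForm⁻¹ˢ⇒rightForm : ∀ {S T g α} → _≐_ G (T ⁻¹ˢ) (leftForm G g α S) → _≐_ G T (rightForm G g α S)
  leftForm⁻¹ˢ⇒rightForm {S} {T} {g} {α} T⁻¹≐ x =
    ⇔-sym (rightForm⇔leftForm⁻¹ {S} {g} {α} x) ⇔-∘ (T⁻¹≐ (x ⁻¹) ⇔-∘ subst-⇔ (_∈ T) (sym (⁻¹-involutive x)))

  rightForm⇒leftForm⁻¹ˢ : ∀ {S T g α} → _≐_ G T (rightForm G g α S) → _≐_ G (T ⁻¹ˢ) (leftForm G g α S)
  rightForm⇒leftForm⁻¹ˢ {S} {g = g} {α} T≐ x =
    subst-⇔ (leftForm G g α S) (⁻¹-involutive x) ⇔-∘ (rightForm⇔leftForm⁻¹ {S} {g} {α} (x ⁻¹) ⇔-∘ T≐ (x ⁻¹))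

  module AutomorphismAction (α : Aut G) (g : Carrier) where
    private
      α→ = to (proj₁ α)
      α← = from (proj₁ α)
      α-homo = proj₂ α

    ν-to : Vertex G → Vertex G
    ν-to (inj₁ x) = inj₁ (α→ x)
    ν-to (inj₂ y) = inj₂ (g ⁻¹ ∙ α→ y)

    ν-from : Vertex G → Vertex G
    ν-from (inj₁ x) = inj₁ (α← x)
    ν-from (inj₂ y) = inj₂ (α← (g ∙ y))

    ν : Perm G
    ν = mk↔ₛ′ ν-to ν-from to-from from-to
      where
      to-from : ∀ v → ν-to (ν-from v) ≡ v
      to-from (inj₁ x) = cong inj₁ (strictlyInverseˡ (proj₁ α) x)
      to-from (inj₂ y) = cong inj₂ (trans (cong (g ⁻¹ ∙_) (strictlyInverseˡ (proj₁ α) (g ∙ y))) (\\-leftDividesʳ g y))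
      from-to : ∀ v → ν-from (ν-to v) ≡ v
      from-to (inj₁ x) = cong inj₁ (strictlyInverseʳ (proj₁ α) x)
      from-to (inj₂ y) = cong inj₂ (trans (cong α← (\\-leftDividesˡ g (α→ y))) (strictlyInverseʳ (proj₁ α) y))

    ν-conj : ∀ h v → ν-to (R G h (ν-from v)) ≡ R G (α→ h) v
    ν-conj h (inj₁ x) = cong inj₁ (trans (α-homo (α← x) h) (cong (_∙ α→ h) (strictlyInverseˡ (proj₁ α) x)))
    ν-conj h (inj₂ y) = cong inj₂ (begin
      g ⁻¹ ∙ α→ (α← (g ∙ y) ∙ h)       ≡⟨ cong (g ⁻¹ ∙_) (α-homo _ h) ⟩
      g ⁻¹ ∙ (α→ (α← (g ∙ y)) ∙ α→ h)  ≡⟨ cong (λ z → g ⁻¹ ∙ (z ∙ α→ h)) (strictlyInverseˡ (proj₁ α) (g ∙ y)) ⟩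
      g ⁻¹ ∙ ((g ∙ y) ∙ α→ h)          ≡⟨ assoc (g ⁻¹) (g ∙ y) (α→ h) ⟨
      (g ⁻¹ ∙ (g ∙ y)) ∙ α→ h          ≡⟨ cong (_∙ α→ h) (\\-leftDividesʳ g y) ⟩
      y ∙ α→ h                         ∎)
      where open ≡-Reasoning

    ν-InK : InK G ν
    ν-InK = ((λ h → α→ h , ν-conj h) ,
             (λ k → α← k , λ v → trans (ν-conj (α← k) v) (cong (λ z → R G z v) (strictlyInverseˡ (proj₁ α) k)))) ,
            λ { (inj₁ _) → refl ; (inj₂ _) → refl }

    ν-edge : ∀ {s x y} → y ≡ s ∙ x ⇔ g ⁻¹ ∙ α→ y ≡ (g ⁻¹ ∙ α→ s) ∙ α→ x
    ν-edge {s} {x} {y} = mk⇔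
      (λ y≡sx → trans (cong (λ z → g ⁻¹ ∙ α→ z) y≡sx) (trans (cong (g ⁻¹ ∙_) (α-homo s x)) (sym (assoc _ _ _))))
      (λ eq → trans (sym (strictlyInverseʳ (proj₁ α) y))
        (trans (cong α← (∙-cancelˡ (g ⁻¹) _ _ (trans eq (trans (assoc _ _ _) (cong (g ⁻¹ ∙_) (sym (α-homo s x)))))))
          (strictlyInverseʳ (proj₁ α) (s ∙ x))))

    ν-iso : ∀ {S T} → _≐_ G T (leftForm G g α S) → IsIsomorphism ν (BCay G S) (BCay G T)
    ν-iso {S} {T} T≐ = isIsomorphism λ
      { (inj₁ x) (inj₂ y) → edges x y
      ; (inj₂ y) (inj₁ x) → edges x y
      ; (inj₁ _) (inj₁ _) → mk⇔ (λ ()) (λ ())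
      ; (inj₂ _) (inj₂ _) → mk⇔ (λ ()) (λ ())
      }
      where
      edges : ∀ x y → (∃ λ s → s ∈ S × y ≡ s ∙ x) ⇔ (∃ λ t → t ∈ T × g ⁻¹ ∙ α→ y ≡ t ∙ α→ x)
      edges x y = mk⇔
        (λ (s , s∈S , y≡sx) → g ⁻¹ ∙ α→ s , Equivalence.from (T≐ _) (s , s∈S , refl) , Equivalence.to ν-edge y≡sx)
        (λ (t , t∈T , eq) → let (s , s∈S , t≡) = Equivalence.to (T≐ t) t∈T in
          s , s∈S , Equivalence.from ν-edge (trans eq (cong (_∙ α→ x) t≡)))

  Image : (Carrier → Carrier) → Subset G → Carrier → Set
  Image f X x = ∃ λ s → s ∈ X × x ≡ f s

  G₁-vertex : ∀ {v} → part G v ≡ false → v ≡ inj₁ (el v)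
  G₁-vertex {inj₁ _} _ = refl

  G₂-vertex : ∀ {v} → part G v ≡ true → v ≡ inj₂ (el v)
  G₂-vertex {inj₂ _} _ = refl

  -- T is read off from the neighbours (t ∙ a)₂ of n(1₁) = a₁, the images of the neighbours s₂ of 1₁.
  neighbourhood : ∀ {S T n a f} → IsIsomorphism n (BCay G S) (BCay G T) →
                  to n (inj₁ ε) ≡ inj₁ a → (∀ y → to n (inj₂ y) ≡ inj₂ (f y ∙ a)) → _≐_ G T (Image f S)
  neighbourhood {S} {T} {n} {a} {f} n-iso n₁ n₂ x = mk⇔
    (λ x∈T → preimage (from n (inj₂ (x ∙ a))) (strictlyInverseˡ n _)
      (reflects n-iso (subst₂ (BCay G T) (sym n₁) (sym (strictlyInverseˡ n _)) (Equivalence.to ∈⇔BCay x∈T))))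
    (λ (s , s∈S , x≡fs) → ∈-resp-≡ (sym x≡fs) (Equivalence.from ∈⇔BCay
      (subst₂ (BCay G T) n₁ (n₂ s) (preserves n-iso (s , s∈S , sym (identityʳ s))))))
    where
    preimage : ∀ u → to n u ≡ inj₂ (x ∙ a) → BCay G S (inj₁ ε) u → Image f S x
    preimage (inj₂ y) n-u (s , s∈S , y≡sε) = s , s∈S ,
      trans (∙-cancelʳ a _ _ (cong el (trans (sym n-u) (n₂ y)))) (cong f (trans y≡sε (identityʳ s)))

  -- σ is the automorphism of G by which n ∈ N conjugates R(G): n R(g) n⁻¹ = R(σ g).
  module Normaliser {n : Perm G} (n∈N : InN G n) where
    open ≡-Reasoning

    σ : Carrier → Carrier
    σ g = proj₁ (proj₁ n∈N g)

    τ : Carrier → Carrier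
    τ h = proj₁ (proj₂ n∈N h)

    to-R : ∀ g v → to n (R G g v) ≡ R G (σ g) (to n v)
    to-R g v = trans (cong (to n ∘ R G g) (sym (strictlyInverseʳ n v))) (proj₂ (proj₁ n∈N g) (to n v))

    σ-τ : ∀ h → σ (τ h) ≡ h
    σ-τ h = R-injective (inj₁ ε) (begin
      R G (σ (τ h)) (inj₁ ε)                  ≡⟨ cong (R G (σ (τ h))) (strictlyInverseˡ n (inj₁ ε)) ⟨
      R G (σ (τ h)) (to n (from n (inj₁ ε)))  ≡⟨ to-R (τ h) _ ⟨
      to n (R G (τ h) (from n (inj₁ ε)))      ≡⟨ proj₂ (proj₂ n∈N h) (inj₁ ε) ⟩
      R G h (inj₁ ε)                          ∎)

    σ-injective : ∀ {x y} → σ x ≡ σ y → x ≡ y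
    σ-injective {x} {y} σx≡σy = R-injective (inj₁ ε) (begin
      R G x (inj₁ ε)                   ≡⟨ strictlyInverseʳ n _ ⟨
      from n (to n (R G x (inj₁ ε)))   ≡⟨ cong (from n) (to-R x _) ⟩
      from n (R G (σ x) (to n (inj₁ ε))) ≡⟨ cong (λ g → from n (R G g (to n (inj₁ ε)))) σx≡σy ⟩
      from n (R G (σ y) (to n (inj₁ ε))) ≡⟨ cong (from n) (to-R y _) ⟨
      from n (to n (R G y (inj₁ ε)))   ≡⟨ strictlyInverseʳ n _ ⟩
      R G y (inj₁ ε)                   ∎)

    σ-homo : ∀ x y → σ (x ∙ y) ≡ σ x ∙ σ y
    σ-homo x y = R-injective (to n (inj₁ ε)) (begin
      R G (σ (x ∙ y)) (to n (inj₁ ε))        ≡⟨ to-R (x ∙ y) _ ⟨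
      to n (R G (x ∙ y) (inj₁ ε))            ≡⟨ cong (to n) (R-∙ y x _) ⟨
      to n (R G y (R G x (inj₁ ε)))          ≡⟨ to-R y _ ⟩
      R G (σ y) (to n (R G x (inj₁ ε)))      ≡⟨ cong (R G (σ y)) (to-R x _) ⟩
      R G (σ y) (R G (σ x) (to n (inj₁ ε)))  ≡⟨ R-∙ (σ y) (σ x) _ ⟩
      R G (σ x ∙ σ y) (to n (inj₁ ε))        ∎)

    σ-aut : Aut G
    σ-aut = mk↔ₛ′ σ τ σ-τ (λ g → σ-injective (σ-τ (σ g))) , σ-homo

    to-inj₁ : ∀ x → to n (inj₁ x) ≡ R G (σ x) (to n (inj₁ ε))
    to-inj₁ x = trans (cong (to n ∘ inj₁) (sym (identityˡ x))) (to-R x (inj₁ ε))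

    to-inj₂ : ∀ y → to n (inj₂ y) ≡ R G (σ y) (to n (inj₂ ε))
    to-inj₂ y = trans (cong (to n ∘ inj₂) (sym (identityˡ y))) (to-R y (inj₂ ε))

    part-to-inj₁ : ∀ x → part G (to n (inj₁ x)) ≡ part G (to n (inj₁ ε))
    part-to-inj₁ x = trans (cong (part G) (to-inj₁ x)) (part-R _ _)

    part-to-inj₂ : ∀ y → part G (to n (inj₂ y)) ≡ part G (to n (inj₂ ε))
    part-to-inj₂ y = trans (cong (part G) (to-inj₂ y)) (part-R _ _)

    -- Otherwise n, being onto, would miss the part opposite to that of n(1₁).
    parts-differ : part G (to n (inj₁ ε)) ≢ part G (to n (inj₂ ε))
    parts-differ same = not-¬ w-part (part-swap (to n (inj₁ ε)))
      where
      one-part : ∀ v → part G (to n v) ≡ part G (to n (inj₁ ε))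
      one-part (inj₁ x) = part-to-inj₁ x
      one-part (inj₂ y) = trans (part-to-inj₂ y) (sym same)
      w = swap (to n (inj₁ ε))
      w-part : part G w ≡ part G (to n (inj₁ ε))
      w-part = trans (cong (part G) (sym (strictlyInverseˡ n w))) (one-part (from n w))

    preservesParts : PreservesParts G n
    preservesParts with part G (to n (inj₁ ε)) in p₁ | part G (to n (inj₂ ε)) in p₂
    ... | false | true  = inj₁ λ { (inj₁ x) → trans (part-to-inj₁ x) p₁ ; (inj₂ y) → trans (part-to-inj₂ y) p₂ }
    ... | true  | false = inj₂ λ { (inj₁ x) → trans (part-to-inj₁ x) p₁ ; (inj₂ y) → trans (part-to-inj₂ y) p₂ }
    ... | false | false = ⊥-elim (parts-differ (trans p₁ (sym p₂)))
    ... | true  | true  = ⊥-elim (parts-differ (trans p₁ (sym p₂)))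

  K⇒leftForm : ∀ {S T n} → InK G n → IsIsomorphism n (BCay G S) (BCay G T) →
               ∃ λ α → ∃ λ g → _≐_ G T (leftForm G g α S)
  K⇒leftForm {n = n} (n∈N , n-parts) n-iso = α , a ∙ b ⁻¹ , neighbourhood n-iso n₁ n₂
    where
    open Normaliser {n} n∈N
    open ≡-Reasoning
    a = el (to n (inj₁ ε))
    b = el (to n (inj₂ ε))
    α = inner a ∘ᴬ σ-aut

    n₁ : to n (inj₁ ε) ≡ inj₁ a
    n₁ = G₁-vertex (n-parts (inj₁ ε))

    -- n(y₂) = (b ∙ σ y)₂ = (g⁻¹ ∙ α y ∙ a)₂ for α = a σ(-) a⁻¹ and g = a b⁻¹.

    n₂ : ∀ y → to n (inj₂ y) ≡ inj₂ (((a ∙ b ⁻¹) ⁻¹ ∙ to (proj₁ α) y) ∙ a)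
    n₂ y = trans (to-inj₂ y) (trans (cong (R G (σ y)) (G₂-vertex (n-parts (inj₂ ε)))) (cong inj₂ (sym (begin
      ((a ∙ b ⁻¹) ⁻¹ ∙ ((a ∙ σ y) ∙ a ⁻¹)) ∙ a  ≡⟨ assoc _ _ a ⟩
      (a ∙ b ⁻¹) ⁻¹ ∙ (((a ∙ σ y) ∙ a ⁻¹) ∙ a)  ≡⟨ cong₂ _∙_ ([x∙y⁻¹]⁻¹≡y∙x⁻¹ a b) (//-rightDividesˡ a (a ∙ σ y)) ⟩
      (b ∙ a ⁻¹) ∙ (a ∙ σ y)                    ≡⟨ assoc b (a ⁻¹) (a ∙ σ y) ⟩
      b ∙ (a ⁻¹ ∙ (a ∙ σ y))                    ≡⟨ cong (b ∙_) (\\-leftDividesʳ a (σ y)) ⟩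
      b ∙ σ y                                   ∎))))

  N⇒forms : ∀ {S T n} → InN G n → IsIsomorphism n (BCay G S) (BCay G T) →
            ∃ λ α → ∃ λ g → _≐_ G T (leftForm G g α S) ⊎ _≐_ G T (rightForm G g α S)
  N⇒forms {S} {T} {n} n∈N n-iso with Normaliser.preservesParts {n} n∈N
  ... | inj₁ n-parts = let (α , g , T≐) = K⇒leftForm (n∈N , n-parts) n-iso in α , g , inj₁ T≐
  ... | inj₂ n-swaps = let (α , g , T⁻¹≐) = K⇒leftForm (InN-∘ {n} {swap↔} n∈N swap-InN , swapped-parts) swapped-iso in
                       α , g , inj₂ (leftForm⁻¹ˢ⇒rightForm {S} {T} {g} {α} T⁻¹≐)
    where
    swapped-parts : ∀ v → part G (swap (to n v)) ≡ part G v
    swapped-parts v = trans (part-swap (to n v)) (trans (cong not (n-swaps v)) (not-involutive (part G v)))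
    swapped-iso : IsIsomorphism (↔-trans n swap↔) (BCay G S) (BCay G (T ⁻¹ˢ))
    swapped-iso = iso-∘ n-iso (swap-iso (λ _ → refl))

  leftForm⇒K : ∀ {S T g α} → _≐_ G T (leftForm G g α S) → ∃ λ n → InK G n × IsIsomorphism n (BCay G S) (BCay G T)
  leftForm⇒K {g = g} {α} T≐ = ν , ν-InK , ν-iso T≐
    where open AutomorphismAction α g

  rightForm⇒N : ∀ {S T g α} → _≐_ G T (rightForm G g α S) → ∃ λ n → InN G n × IsIsomorphism n (BCay G S) (BCay G T)
  rightForm⇒N {S} {T} {g} {α} T≐ =
    ↔-trans ν swap↔ , InN-∘ {ν} {swap↔} (proj₁ ν-InK) swap-InN ,
    iso-∘ (ν-iso (rightForm⇒leftForm⁻¹ˢ {S} {T} {g} {α} T≐)) (swap-iso (λ x → cong T (sym (⁻¹-involutive x))))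
    where open AutomorphismAction α g

corollary3p2 : (G : FiniteGroup) (S : Subset G) →
    (Is2PCI G S ⇔ (∀ (T : Subset G) → Isomorphic G (BCay G S) (BCay G T) →
        ∃ λ (α : Aut G) → ∃ λ g →
          (_≐_ G T (leftForm G g α S)) ⊎ (_≐_ G T (rightForm G g α S))))
    × (IsK2PCI G S ⇔ (∀ (T : Subset G) → Isomorphic G (BCay G S) (BCay G T) →
        ∃ λ (α : Aut G) → ∃ λ g → _≐_ G T (leftForm G g α S)))
corollary3p2 G S =
  mk⇔ (λ 2PCI T (φ , φ-maps) →
         let (n , n∈N , n-maps) = 2PCI T (partPreserving φ φ-maps)
         in N⇒forms {S} {T} {n} n∈N (isIsomorphism n-maps))
      (λ forms T (φ , _ , φ-maps) → case forms T (φ , φ-maps) of λ where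
         (α , g , inj₁ T≐) → let (n , n∈K , n-iso) = leftForm⇒K {S} {T} {g} {α} T≐ in n , proj₁ n∈K , adjacent⇔ n-iso
         (α , g , inj₂ T≐) → let (n , n∈N , n-iso) = rightForm⇒N {S} {T} {g} {α} T≐ in n , n∈N , adjacent⇔ n-iso) ,
  mk⇔ (λ K2PCI T (φ , φ-maps) →
         let (n , n∈K , n-maps) = K2PCI T (partPreserving φ φ-maps)
         in K⇒leftForm {S} {T} {n} n∈K (isIsomorphism n-maps))
      (λ forms T (φ , _ , φ-maps) →
         let (α , g , T≐) = forms T (φ , φ-maps)
             (n , n∈K , n-iso) = leftForm⇒K {S} {T} {g} {α} T≐
         in n , n∈K , adjacent⇔ n-iso)
  where
  open Cayley G
  partPreserving : ∀ {T} φ → MapsTo G φ (BCay G S) (BCay G T) →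
                   ∃ λ ψ → PreservesParts G ψ × MapsTo G ψ (BCay G S) (BCay G T)
  partPreserving φ φ-maps = let (ψ , ψ-parts , ψ-iso) = partPreservingIsomorphism φ (isIsomorphism φ-maps)
                            in ψ , ψ-parts , adjacent⇔ ψ-iso
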